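{- Let $G=(V,E)$ be a connected simple graph with $n=|V|$ vertices and $m=|E|$ edges such that $\deg(u)+\deg(v)\le n$ for every edge $uv\in E$. Then $$H(G)\ \ge\ \frac{2m}{n},$$ with equality if and only if $\deg(u)+\deg(v)=n$ for every edge $uv\in E$. Moreover, every triangle-free graph satisfies the hypothesis $\deg(u)+\deg(v)\le n$ for all edges $uv$, and if $G$ is triangle-free then equality $H(G)=\frac{2m}{n}$ holds if and only if $G$ is isomorphic to a complete bipartite graph $K_{a,b}$ with $a+b=n$.
   Context: For a graph $G=(V,E)$, $\deg(v)$ denotes the degree of a vertex $v$. The harmonic index of $G$ is $H(G)=\sum_{uv\in E}\frac{2}{\deg(u)+\deg(v)}$. -}

module Defs where

open import Data.Nat as ℕ using (ℕ; zero; suc; NonZero; _<_)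
open import Data.Integer using (+_)
open import Data.Rational as ℚ using (ℚ; 0ℚ; _/_)
open import Data.Bool using (Bool; true; false; if_then_else_; _xor_)
open import Data.Fin using (Fin; zero; suc; toℕ)
open import Data.Fin.Properties using ()
open import Data.Nat.Properties using ()
open import Data.Empty using (⊥)
open import Data.Product using (Σ)
open import Function.Bundles using (_↔_; Inverse)
open import Relation.Binary.PropositionalEquality using (_≡_)
open import Relation.Nullary using (does)

record Graph (n : ℕ) : Set where
  field
    adj    : Fin n → Fin n → Bool
    sym    : ∀ i j → adj i j ≡ adj j i
    irrefl : ∀ i → adj i i ≡ false
open Graph public

Σℕ : (n : ℕ) → (Fin n → ℕ) → ℕ
Σℕ zero    f = 0
Σℕ (suc n) f = f zero ℕ.+ Σℕ n (λ i → f (suc i))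

Σℚ : (n : ℕ) → (Fin n → ℚ) → ℚ
Σℚ zero    f = 0ℚ
Σℚ (suc n) f = f zero ℚ.+ Σℚ n (λ i → f (suc i))

deg : ∀ {n} → Graph n → Fin n → ℕ
deg {n} G i = Σℕ n (λ j → if adj G i j then 1 else 0)

-- is {i,j} an edge, counted once via i < j
isEdge< : ∀ {n} → Graph n → Fin n → Fin n → Bool
isEdge< G i j = if does (toℕ i ℕ.<? toℕ j) then adj G i j else false

numEdges : ∀ {n} → Graph n → ℕ
numEdges {n} G = Σℕ n (λ i → Σℕ n (λ j → if isEdge< G i j then 1 else 0))

-- 2 / d as a rational (d = 0 never occurs for an edge; mapped to 0)
twoOver : ℕ → ℚ
twoOver zero    = 0ℚ
twoOver (suc d) = + 2 / suc d

harmonic : ∀ {n} → Graph n → ℚ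
harmonic {n} G =
  Σℚ n (λ i → Σℚ n (λ j →
    if isEdge< G i j then twoOver (deg G i ℕ.+ deg G j) else 0ℚ))

data Reach {n} (G : Graph n) : Fin n → Fin n → Set where
  here : ∀ {i} → Reach G i i
  step : ∀ {i j k} → adj G i j ≡ true → Reach G j k → Reach G i k

Connected : ∀ {n} → Graph n → Set
Connected {n} G = ∀ (i j : Fin n) → Reach G i j

TriangleFree : ∀ {n} → Graph n → Set
TriangleFree G = ∀ i j k → adj G i j ≡ true → adj G j k ≡ true → adj G i k ≡ true → ⊥

inA : ∀ {a b} → Fin (a ℕ.+ b) → Bool
inA {a} x = does (toℕ x ℕ.<? a)

xor-sym : ∀ x y → (x xor y) ≡ (y xor x)
xor-sym true  true  = _≡_.refl
xor-sym true  false = _≡_.refl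
xor-sym false true  = _≡_.refl
xor-sym false false = _≡_.refl

xor-self : ∀ x → (x xor x) ≡ false
xor-self true  = _≡_.refl
xor-self false = _≡_.refl

K : (a b : ℕ) → Graph (a ℕ.+ b)
adj    (K a b) i j = inA {a} {b} i xor inA {a} {b} j
sym    (K a b) i j = xor-sym (inA {a} {b} i) (inA {a} {b} j)
irrefl (K a b) i   = xor-self (inA {a} {b} i)

Iso : ∀ {n n'} → Graph n → Graph n' → Set
Iso {n} {n'} G G' =
  Σ (Fin n ↔ Fin n') (λ f → ∀ i j → adj G i j ≡ adj G' (Inverse.to f i) (Inverse.to f j))

-- Each edge uv contributes 2 / (deg u + deg v) ≥ 2 / n to H(G), and there are m edges, so H(G) ≥ 2m/n,
-- with equality exactly when every edge has deg u + deg v = n. In a triangle-free graph the neighbourhoods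
-- of adjacent u and v are disjoint, which gives deg u + deg v ≤ n; equality then says that every vertex is
-- adjacent to exactly one of u and v. Hence, fixing one edge uv, adjacency to u is a 2-colouring c with
-- adj x y = c x xor c y, i.e. G ≅ K(a, b).
module Submission where

open import Defs hiding (sym)
open import Data.Bool using (Bool; true; false; not; if_then_else_; _xor_)
import Data.Bool.Properties as BoolP
open import Data.Empty using (⊥-elim; ⊥-elim-irr)
open import Data.Fin using (Fin; zero; suc; toℕ; join; _↑ˡ_; _↑ʳ_)
import Data.Fin.Properties as FinP
open import Data.Integer as ℤ using (+_)
import Data.Integer.Properties as ℤP
open import Data.Integer.Tactic.RingSolver using (solve-∀)
open import Data.Nat as ℕ using (ℕ; zero; suc; NonZero; _+_; _*_; _≤_; _<_; z≤n; s≤s)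
import Data.Nat.Properties as ℕP
open import Algebra.Properties.CommutativeSemigroup ℕP.+-commutativeSemigroup
  using () renaming (interchange to +-interchange)
open import Data.Product using (_×_; Σ; ∃; ∃₂; _,_)
open import Data.Rational as ℚ using (ℚ; 0ℚ; _/_; fromℚᵘ; toℚᵘ)
import Data.Rational.Properties as ℚP
import Data.Rational.Unnormalised as ℚᵘ
import Data.Rational.Unnormalised.Properties as ℚᵘP
open import Data.Sum using (_⊎_; inj₁; inj₂; swap; map)
open import Data.Sum.Algebra using (⊎-assoc; ⊎-comm; ⊎-cong)
open import Function using (_∘_)
open import Function.Bundles using (_⇔_; _↔_; Inverse; Equivalence; mk⇔)
open import Function.Construct.Composition using (_↔-∘_)
open import Function.Construct.Identity using (↔-id)
open import Function.Construct.Symmetry using (↔-sym)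
open import Relation.Binary.Definitions using (tri<; tri≈; tri>)
open import Relation.Binary.PropositionalEquality
  using (_≡_; refl; sym; trans; cong; cong₂; subst; subst₂; module ≡-Reasoning)
open import Relation.Nullary using (yes; no; does; contradiction)
open import Relation.Nullary.Decidable using (dec-true; dec-false)

fromℚᵘ-homo-+ : ∀ p q → fromℚᵘ (p ℚᵘ.+ q) ≡ fromℚᵘ p ℚ.+ fromℚᵘ q
fromℚᵘ-homo-+ p q = ℚP.toℚᵘ-injective (begin-equality
  toℚᵘ (fromℚᵘ (p ℚᵘ.+ q))             ≃⟨ ℚP.toℚᵘ-fromℚᵘ (p ℚᵘ.+ q) ⟩
  p ℚᵘ.+ q                              ≃⟨ ℚᵘP.+-cong (ℚP.toℚᵘ-fromℚᵘ p) (ℚP.toℚᵘ-fromℚᵘ q) ⟨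
  toℚᵘ (fromℚᵘ p) ℚᵘ.+ toℚᵘ (fromℚᵘ q) ≃⟨ ℚP.toℚᵘ-homo-+ (fromℚᵘ p) (fromℚᵘ q) ⟨
  toℚᵘ (fromℚᵘ p ℚ.+ fromℚᵘ q)         ∎)
  where open ℚᵘP.≤-Reasoning

fromℚᵘ-mono-≤ : ∀ {p q} → p ℚᵘ.≤ q → fromℚᵘ p ℚ.≤ fromℚᵘ q
fromℚᵘ-mono-≤ {p} {q} p≤q = ℚP.toℚᵘ-cancel-≤
  (ℚᵘP.≤-respˡ-≃ (ℚᵘP.≃-sym (ℚP.toℚᵘ-fromℚᵘ p)) (ℚᵘP.≤-respʳ-≃ (ℚᵘP.≃-sym (ℚP.toℚᵘ-fromℚᵘ q)) p≤q))

fromℚᵘ-mono-< : ∀ {p q} → p ℚᵘ.< q → fromℚᵘ p ℚ.< fromℚᵘ q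
fromℚᵘ-mono-< {p} {q} p<q = ℚP.toℚᵘ-cancel-<
  (ℚᵘP.<-respˡ-≃ (ℚᵘP.≃-sym (ℚP.toℚᵘ-fromℚᵘ p)) (ℚᵘP.<-respʳ-≃ (ℚᵘP.≃-sym (ℚP.toℚᵘ-fromℚᵘ q)) p<q))

-- Both sides are fromℚᵘ of unnormalised fractions, since i / suc d = fromℚᵘ (mkℚᵘ i d).
/-distribʳ-+ : ∀ a b d → + (a + b) / suc d ≡ + a / suc d ℚ.+ + b / suc d
/-distribʳ-+ a b d =
  trans (ℚP.fromℚᵘ-cong common-denominator) (fromℚᵘ-homo-+ (ℚᵘ.mkℚᵘ (+ a) d) (ℚᵘ.mkℚᵘ (+ b) d))
  where
  cross : ∀ x y z → (x ℤ.+ y) ℤ.* (z ℤ.* z) ≡ (x ℤ.* z ℤ.+ y ℤ.* z) ℤ.* z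
  cross = solve-∀
  common-denominator : ℚᵘ.mkℚᵘ (+ (a + b)) d ℚᵘ.≃ ℚᵘ.mkℚᵘ (+ a) d ℚᵘ.+ ℚᵘ.mkℚᵘ (+ b) d
  common-denominator = ℚᵘ.*≡*
    (trans (cong (ℤ._* (+ suc d ℤ.* + suc d)) (ℤP.pos-+ a b)) (cross (+ a) (+ b) (+ suc d)))

/-antimonoʳ-≤ : ∀ k {d e} → d ≤ e → + k / suc e ℚ.≤ + k / suc d
/-antimonoʳ-≤ k {d} {e} d≤e = fromℚᵘ-mono-≤ {ℚᵘ.mkℚᵘ (+ k) e} {ℚᵘ.mkℚᵘ (+ k) d}
  (ℚᵘ.*≤* (subst₂ ℤ._≤_ (ℤP.pos-* k (suc d)) (ℤP.pos-* k (suc e))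
    (ℤ.+≤+ (ℕP.*-monoʳ-≤ k (s≤s d≤e)))))

/-antimonoʳ-< : ∀ k .{{_ : NonZero k}} {d e} → d < e → + k / suc e ℚ.< + k / suc d
/-antimonoʳ-< k {d} {e} d<e = fromℚᵘ-mono-< {ℚᵘ.mkℚᵘ (+ k) e} {ℚᵘ.mkℚᵘ (+ k) d}
  (ℚᵘ.*<* (subst₂ ℤ._<_ (ℤP.pos-* k (suc d)) (ℤP.pos-* k (suc e))
    (ℤ.+<+ (ℕP.*-monoʳ-< k (s≤s d<e)))))

twoOver-≥ : ∀ {s} k → 0 < s → s ≤ suc k → + 2 / suc k ℚ.≤ twoOver s
twoOver-≥ k (s≤s _) (s≤s d≤k) = /-antimonoʳ-≤ 2 d≤k

twoOver-> : ∀ {s} k → 0 < s → s < suc k → + 2 / suc k ℚ.< twoOver s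
twoOver-> k (s≤s _) (s≤s d<k) = /-antimonoʳ-< 2 d<k

indicator : Bool → ℕ
indicator b = if b then 1 else 0

indicator-+≡1⇔xor : ∀ a b → (indicator a + indicator b ≡ 1) ⇔ (a xor b ≡ true)
indicator-+≡1⇔xor true  true  = mk⇔ (λ ()) (λ ())
indicator-+≡1⇔xor true  false = mk⇔ (λ _ → refl) (λ _ → refl)
indicator-+≡1⇔xor false true  = mk⇔ (λ _ → refl) (λ _ → refl)
indicator-+≡1⇔xor false false = mk⇔ (λ ()) (λ ())

xor-cancelʳ : ∀ a b x → (a xor x) xor (b xor x) ≡ a xor b
xor-cancelʳ true  true  true  = refl
xor-cancelʳ true  true  false = refl
xor-cancelʳ true  false true  = refl
xor-cancelʳ true  false false = refl
xor-cancelʳ false true  true  = refl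
xor-cancelʳ false true  false = refl
xor-cancelʳ false false true  = refl
xor-cancelʳ false false false = refl

xor≡true⇒≡not : ∀ a b → a xor b ≡ true → b ≡ not a
xor≡true⇒≡not true  false _  = refl
xor≡true⇒≡not false true  _  = refl
xor≡true⇒≡not true  true  ()
xor≡true⇒≡not false false ()

Σℕ-cong : ∀ n {f g : Fin n → ℕ} → (∀ i → f i ≡ g i) → Σℕ n f ≡ Σℕ n g
Σℕ-cong zero    f≗g = refl
Σℕ-cong (suc n) f≗g = cong₂ _+_ (f≗g zero) (Σℕ-cong n (f≗g ∘ suc))

Σℕ-distrib-+ : ∀ n (f g : Fin n → ℕ) → Σℕ n (λ i → f i + g i) ≡ Σℕ n f + Σℕ n g
Σℕ-distrib-+ zero    f g = refl
Σℕ-distrib-+ (suc n) f g =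
  trans (cong (_+_ (f zero + g zero)) (Σℕ-distrib-+ n (f ∘ suc) (g ∘ suc)))
        (+-interchange (f zero) (g zero) (Σℕ n (f ∘ suc)) (Σℕ n (g ∘ suc)))

Σℕ-*-distribˡ : ∀ n k (f : Fin n → ℕ) → Σℕ n (λ i → k * f i) ≡ k * Σℕ n f
Σℕ-*-distribˡ zero    k f = sym (ℕP.*-zeroʳ k)
Σℕ-*-distribˡ (suc n) k f =
  trans (cong (_+_ (k * f zero)) (Σℕ-*-distribˡ n k (f ∘ suc))) (sym (ℕP.*-distribˡ-+ k (f zero) _))

Σℕ-1 : ∀ n → Σℕ n (λ _ → 1) ≡ n
Σℕ-1 zero    = refl
Σℕ-1 (suc n) = cong suc (Σℕ-1 n)

term≤Σℕ : ∀ n (f : Fin n → ℕ) i → f i ≤ Σℕ n f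
term≤Σℕ (suc n) f zero    = ℕP.m≤m+n (f zero) _
term≤Σℕ (suc n) f (suc i) = ℕP.≤-trans (term≤Σℕ n (f ∘ suc) i) (ℕP.m≤n+m _ (f zero))

Σℕ-mono-≤ : ∀ n {f g : Fin n → ℕ} → (∀ i → f i ≤ g i) → Σℕ n f ≤ Σℕ n g
Σℕ-mono-≤ zero    f≤g = z≤n
Σℕ-mono-≤ (suc n) f≤g = ℕP.+-mono-≤ (f≤g zero) (Σℕ-mono-≤ n (f≤g ∘ suc))

Σℕ-mono-< : ∀ n {f g : Fin n → ℕ} → (∀ i → f i ≤ g i) → ∀ k → f k < g k → Σℕ n f < Σℕ n g
Σℕ-mono-< (suc n) f≤g zero    fk<gk = ℕP.+-mono-<-≤ fk<gk (Σℕ-mono-≤ n (f≤g ∘ suc))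
Σℕ-mono-< (suc n) f≤g (suc k) fk<gk = ℕP.+-mono-≤-< (f≤g zero) (Σℕ-mono-< n (f≤g ∘ suc) k fk<gk)

Σℕ-≡⇒pointwise-≡ : ∀ n {f g : Fin n → ℕ} → (∀ i → f i ≤ g i) → Σℕ n f ≡ Σℕ n g → ∀ i → f i ≡ g i
Σℕ-≡⇒pointwise-≡ n {f} {g} f≤g Σf≡Σg i with f i ℕP.≟ g i
... | yes fi≡gi = fi≡gi
... | no  fi≢gi = contradiction Σf≡Σg (ℕP.<⇒≢ (Σℕ-mono-< n f≤g i (ℕP.≤∧≢⇒< (f≤g i) fi≢gi)))

Σℚ-cong : ∀ n {f g : Fin n → ℚ} → (∀ i → f i ≡ g i) → Σℚ n f ≡ Σℚ n g
Σℚ-cong zero    f≗g = refl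
Σℚ-cong (suc n) f≗g = cong₂ ℚ._+_ (f≗g zero) (Σℚ-cong n (f≗g ∘ suc))

Σℚ-mono-≤ : ∀ n {f g : Fin n → ℚ} → (∀ i → f i ℚ.≤ g i) → Σℚ n f ℚ.≤ Σℚ n g
Σℚ-mono-≤ zero    f≤g = ℚP.≤-refl
Σℚ-mono-≤ (suc n) f≤g = ℚP.+-mono-≤ (f≤g zero) (Σℚ-mono-≤ n (f≤g ∘ suc))

Σℚ-mono-< : ∀ n {f g : Fin n → ℚ} → (∀ i → f i ℚ.≤ g i) → ∀ k → f k ℚ.< g k → Σℚ n f ℚ.< Σℚ n g
Σℚ-mono-< (suc n) f≤g zero    fk<gk = ℚP.+-mono-<-≤ fk<gk (Σℚ-mono-≤ n (f≤g ∘ suc))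
Σℚ-mono-< (suc n) f≤g (suc k) fk<gk = ℚP.+-mono-≤-< (f≤g zero) (Σℚ-mono-< n (f≤g ∘ suc) k fk<gk)

Σℚ-/ : ∀ n d (f : Fin n → ℕ) → Σℚ n (λ i → + f i / suc d) ≡ + Σℕ n f / suc d
Σℚ-/ zero    d f = sym (ℚP.0/n≡0 (suc d))
Σℚ-/ (suc n) d f =
  trans (cong (+ f zero / suc d ℚ.+_) (Σℚ-/ n d (f ∘ suc))) (sym (/-distribʳ-+ (f zero) _ d))

isInj₁ : ∀ {A B : Set} → A ⊎ B → Bool
isInj₁ (inj₁ _) = true
isInj₁ (inj₂ _) = false

isInj₁-map : ∀ {A B C D : Set} (f : A → C) (g : B → D) s → isInj₁ (map f g s) ≡ isInj₁ s
isInj₁-map f g (inj₁ _) = refl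
isInj₁-map f g (inj₂ _) = refl

isInj₁-swap : ∀ {A B : Set} (s : A ⊎ B) → isInj₁ (swap s) ≡ not (isInj₁ s)
isInj₁-swap (inj₁ _) = refl
isInj₁-swap (inj₂ _) = refl

record ColourSplit (n : ℕ) (c : Fin n → Bool) : Set where
  field
    a b    : ℕ
    sizes  : a + b ≡ n
    bij    : Fin n ↔ (Fin a ⊎ Fin b)
    colour : ∀ x → isInj₁ (Inverse.to bij x) ≡ c x

swapSplit : ∀ {n c c′} → ColourSplit n c → (∀ x → c′ x ≡ not (c x)) → ColourSplit n c′
swapSplit S c′≡not-c = record
  { a      = b
  ; b      = a
  ; sizes  = trans (ℕP.+-comm b a) sizes
  ; bij    = ⊎-comm _ _ ↔-∘ bij
  ; colour = λ x → trans (isInj₁-swap (Inverse.to bij x)) (trans (cong not (colour x)) (sym (c′≡not-c x)))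
  }
  where open ColourSplit S

consSplit : ∀ {n c} → ColourSplit n (c ∘ suc) → c zero ≡ true → ColourSplit (suc n) c
consSplit {n} {c} S c₀ = record { a = suc a ; b = b ; sizes = cong suc sizes ; bij = bij′ ; colour = colour′ }
  where
  open ColourSplit S
  -- Fin (1 + n) ↔ Fin 1 ⊎ Fin n ↔ Fin 1 ⊎ (Fin a ⊎ Fin b) ↔ (Fin 1 ⊎ Fin a) ⊎ Fin b ↔ Fin (1 + a) ⊎ Fin b
  bij′ : Fin (suc n) ↔ (Fin (suc a) ⊎ Fin b)
  bij′ = ⊎-cong (↔-sym FinP.+↔⊎) (↔-id _) ↔-∘ (↔-sym (⊎-assoc _ _ _ _) ↔-∘ (⊎-cong (↔-id _) bij ↔-∘ FinP.+↔⊎ {1}))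
  colour′ : ∀ x → isInj₁ (Inverse.to bij′ x) ≡ c x
  colour′ zero    = sym c₀
  colour′ (suc x) = trans (isInj₁-map _ _ _) (trans (isInj₁-map _ _ _) (colour x))

colourSplit : ∀ n (c : Fin n → Bool) → ColourSplit n c
colourSplit zero    c = record { a = 0 ; b = 0 ; sizes = refl ; bij = FinP.+↔⊎ ; colour = λ () }
colourSplit (suc n) c with c zero in c₀
... | true  = consSplit (colourSplit n (c ∘ suc)) c₀
... | false = swapSplit (consSplit (swapSplit (colourSplit n (c ∘ suc)) (λ _ → refl)) (cong not c₀))
                        (λ x → sym (BoolP.not-involutive (c x)))

inA-join : ∀ a b (s : Fin a ⊎ Fin b) → inA {a} {b} (join a b s) ≡ isInj₁ s
inA-join a b (inj₁ i) =
  dec-true (toℕ (i ↑ˡ b) ℕ.<? a) (subst (_< a) (sym (FinP.toℕ-↑ˡ i b)) (FinP.toℕ<n i))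
inA-join a b (inj₂ j) =
  dec-false (toℕ (a ↑ʳ j) ℕ.<? a) (λ a+j<a → ℕP.m+n≮m a (toℕ j) (subst (_< a) (FinP.toℕ-↑ʳ a j) a+j<a))

if-true-cong : ∀ b {x y : ℚ} → (b ≡ true → x ≡ y) → (if b then x else 0ℚ) ≡ (if b then y else 0ℚ)
if-true-cong true  x≡y = x≡y refl
if-true-cong false _   = refl

if-true-mono-≤ : ∀ b {x y : ℚ} → (b ≡ true → x ℚ.≤ y) → (if b then x else 0ℚ) ℚ.≤ (if b then y else 0ℚ)
if-true-mono-≤ true  x≤y = x≤y refl
if-true-mono-≤ false _   = ℚP.≤-refl

module _ {n : ℕ} (G : Graph n) where

  isEdge<⇒adj : ∀ {i j} → isEdge< G i j ≡ true → adj G i j ≡ true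
  isEdge<⇒adj {i} {j} e with does (toℕ i ℕ.<? toℕ j)
  ... | true = e

  isEdge<-intro : ∀ {i j} → toℕ i < toℕ j → adj G i j ≡ true → isEdge< G i j ≡ true
  isEdge<-intro {i} {j} i<j a =
    subst (λ b → (if b then adj G i j else false) ≡ true) (sym (dec-true (toℕ i ℕ.<? toℕ j) i<j)) a

  adj⇒isEdge< : ∀ {u v} → adj G u v ≡ true → isEdge< G u v ≡ true ⊎ isEdge< G v u ≡ true
  adj⇒isEdge< {u} {v} a with ℕP.<-cmp (toℕ u) (toℕ v)
  ... | tri< u<v _ _ = inj₁ (isEdge<-intro u<v a)
  ... | tri> _ _ v<u = inj₂ (isEdge<-intro v<u (trans (Graph.sym G v u) a))
  ... | tri≈ _ u≡v _ with FinP.toℕ-injective u≡v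
  ...   | refl = contradiction (trans (sym a) (irrefl G u)) λ ()

  isEdge<⇒deg+deg>0 : ∀ {i j} → isEdge< G i j ≡ true → 0 < deg G i + deg G j
  isEdge<⇒deg+deg>0 {i} {j} e = ℕP.≤-trans
    (subst (λ b → indicator b ≤ deg G i) (isEdge<⇒adj e) (term≤Σℕ n (indicator ∘ adj G i) j))
    (ℕP.m≤m+n (deg G i) (deg G j))

  DegSumBounded : Set
  DegSumBounded = ∀ u v → adj G u v ≡ true → deg G u + deg G v ≤ n

  DegSumTight : Set
  DegSumTight = ∀ u v → adj G u v ≡ true → deg G u + deg G v ≡ n

  deg+deg≡Σ : ∀ u v → deg G u + deg G v ≡ Σℕ n (λ x → indicator (adj G u x) + indicator (adj G v x))
  deg+deg≡Σ u v = sym (Σℕ-distrib-+ n (indicator ∘ adj G u) (indicator ∘ adj G v))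

  -- harmonic G is, by definition, edgeSum (λ i j → twoOver (deg G i + deg G j)).
  edgeSum : (Fin n → Fin n → ℚ) → ℚ
  edgeSum w = Σℚ n (λ i → Σℚ n (λ j → if isEdge< G i j then w i j else 0ℚ))

  edgeSum-cong : ∀ {w w′} → (∀ i j → isEdge< G i j ≡ true → w i j ≡ w′ i j) → edgeSum w ≡ edgeSum w′
  edgeSum-cong w≡w′ = Σℚ-cong n (λ i → Σℚ-cong n (λ j → if-true-cong (isEdge< G i j) (w≡w′ i j)))

  edgeSum-mono-≤ : ∀ {w w′} → (∀ i j → isEdge< G i j ≡ true → w i j ℚ.≤ w′ i j) →
                   edgeSum w ℚ.≤ edgeSum w′
  edgeSum-mono-≤ w≤w′ = Σℚ-mono-≤ n (λ i → Σℚ-mono-≤ n (λ j → if-true-mono-≤ (isEdge< G i j) (w≤w′ i j)))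

  edgeSum-mono-< : ∀ {w w′} → (∀ i j → isEdge< G i j ≡ true → w i j ℚ.≤ w′ i j) →
                   ∀ {i j} → isEdge< G i j ≡ true → w i j ℚ.< w′ i j → edgeSum w ℚ.< edgeSum w′
  edgeSum-mono-< {w} {w′} w≤w′ {i} {j} e wij<w′ij =
    Σℚ-mono-< n (λ i′ → Σℚ-mono-≤ n (term≤ i′)) i (Σℚ-mono-< n (term≤ i) j term<)
    where
    term≤ : ∀ i j → (if isEdge< G i j then w i j else 0ℚ) ℚ.≤ (if isEdge< G i j then w′ i j else 0ℚ)
    term≤ i j = if-true-mono-≤ (isEdge< G i j) (w≤w′ i j)
    term< : (if isEdge< G i j then w i j else 0ℚ) ℚ.< (if isEdge< G i j then w′ i j else 0ℚ)
    term< rewrite e = wij<w′ij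

  edgeSum-const : ∀ c d → edgeSum (λ _ _ → + c / suc d) ≡ + (c * numEdges G) / suc d
  edgeSum-const c d = begin
    edgeSum (λ _ _ → + c / suc d)
      ≡⟨ Σℚ-cong n (λ i → Σℚ-cong n (λ j → term (isEdge< G i j))) ⟩
    Σℚ n (λ i → Σℚ n (λ j → + (c * indicator (isEdge< G i j)) / suc d))
      ≡⟨ Σℚ-cong n (λ i → Σℚ-/ n d (λ j → c * indicator (isEdge< G i j))) ⟩
    Σℚ n (λ i → + Σℕ n (λ j → c * indicator (isEdge< G i j)) / suc d)
      ≡⟨ Σℚ-/ n d (λ i → Σℕ n (λ j → c * indicator (isEdge< G i j))) ⟩
    + Σℕ n (λ i → Σℕ n (λ j → c * indicator (isEdge< G i j))) / suc d
      ≡⟨ cong (λ t → + t / suc d) Σc*≡c*Σ ⟩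
    + (c * numEdges G) / suc d ∎
    where
    open ≡-Reasoning
    term : ∀ b → (if b then + c / suc d else 0ℚ) ≡ + (c * indicator b) / suc d
    term true  = cong (λ t → + t / suc d) (sym (ℕP.*-identityʳ c))
    term false = sym (trans (cong (λ t → + t / suc d) (ℕP.*-zeroʳ c)) (ℚP.0/n≡0 (suc d)))
    Σc*≡c*Σ : Σℕ n (λ i → Σℕ n (λ j → c * indicator (isEdge< G i j))) ≡ c * numEdges G
    Σc*≡c*Σ = trans (Σℕ-cong n (λ i → Σℕ-*-distribˡ n c (λ j → indicator (isEdge< G i j))))
                    (Σℕ-*-distribˡ n c (λ i → Σℕ n (λ j → indicator (isEdge< G i j))))

  neighbourhoods-disjoint : TriangleFree G → ∀ {u v} → adj G u v ≡ true →
                            ∀ x → indicator (adj G u x) + indicator (adj G v x) ≤ 1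
  neighbourhoods-disjoint tf {u} {v} uv x with adj G u x in ux | adj G v x in vx
  ... | true  | true  = ⊥-elim (tf u x v ux (trans (Graph.sym G x v) vx) uv)
  ... | true  | false = ℕP.≤-refl
  ... | false | true  = ℕP.≤-refl
  ... | false | false = z≤n

  triangleFree⇒degSumBounded : TriangleFree G → DegSumBounded
  triangleFree⇒degSumBounded tf u v uv = begin
    deg G u + deg G v                                            ≡⟨ deg+deg≡Σ u v ⟩
    Σℕ n (λ x → indicator (adj G u x) + indicator (adj G v x))  ≤⟨ Σℕ-mono-≤ n (neighbourhoods-disjoint tf uv) ⟩
    Σℕ n (λ _ → 1)                                               ≡⟨ Σℕ-1 n ⟩
    n                                                            ∎
    where open ℕP.≤-Reasoning

  triangleFree⇒adj-xor : TriangleFree G → ∀ {u v} → adj G u v ≡ true → deg G u + deg G v ≡ n →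
                               ∀ x → adj G u x xor adj G v x ≡ true
  triangleFree⇒adj-xor tf {u} {v} uv tight x = Equivalence.to (indicator-+≡1⇔xor (adj G u x) (adj G v x))
    (Σℕ-≡⇒pointwise-≡ n (neighbourhoods-disjoint tf uv) (trans (sym (deg+deg≡Σ u v)) (trans tight (sym (Σℕ-1 n)))) x)

  IsCompleteBipartite : (Fin n → Bool) → Set
  IsCompleteBipartite c = ∀ i j → adj G i j ≡ c i xor c j

  completeBipartite⇒degSumTight : ∀ c → IsCompleteBipartite c → DegSumTight
  completeBipartite⇒degSumTight c bip u v uv = begin
    deg G u + deg G v                                            ≡⟨ deg+deg≡Σ u v ⟩
    Σℕ n (λ x → indicator (adj G u x) + indicator (adj G v x))  ≡⟨ Σℕ-cong n exactly-one ⟩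
    Σℕ n (λ _ → 1)                                               ≡⟨ Σℕ-1 n ⟩
    n                                                            ∎
    where
    open ≡-Reasoning
    exactly-one : ∀ x → indicator (adj G u x) + indicator (adj G v x) ≡ 1
    exactly-one x = Equivalence.from (indicator-+≡1⇔xor (adj G u x) (adj G v x)) (begin
      adj G u x xor adj G v x          ≡⟨ cong₂ _xor_ (bip u x) (bip v x) ⟩
      (c u xor c x) xor (c v xor c x)  ≡⟨ xor-cancelʳ (c u) (c v) (c x) ⟩
      c u xor c v                      ≡⟨ bip u v ⟨
      adj G u v                        ≡⟨ uv ⟩
      true                             ∎)

  -- Colour each vertex by adjacency to one endpoint u of an edge uv.
  triangleFree⇒degSumTight⇒completeBipartite : TriangleFree G → DegSumTight → ∃ IsCompleteBipartite
  triangleFree⇒degSumTight⇒completeBipartite tf tight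
    with FinP.any? (λ u → FinP.any? (λ v → adj G u v BoolP.≟ true))
  ... | no ∄edge = (λ _ → false) , no-edge
    where
    no-edge : ∀ i j → adj G i j ≡ false
    no-edge i j with adj G i j in ij
    ... | true  = ⊥-elim (∄edge (i , j , ij))
    ... | false = refl
  ... | yes (u , v , uv) = adj G u , colouring
    where
    adj-xor : ∀ {p q} → adj G p q ≡ true → ∀ x → adj G p x xor adj G q x ≡ true
    adj-xor pq = triangleFree⇒adj-xor tf pq (tight _ _ pq)
    colouring : ∀ w x → adj G w x ≡ adj G u w xor adj G u x
    colouring w x with adj G u w in uw
    ... | true  = xor≡true⇒≡not (adj G u x) (adj G w x) (adj-xor uw x)
    ... | false = BoolP.not-injective (trans (sym (xor≡true⇒≡not _ _ (adj-xor wv x)))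
                                             (xor≡true⇒≡not _ _ (adj-xor uv x)))
      where
      wv : adj G w v ≡ true
      wv = trans (Graph.sym G w v) (subst (λ b → b xor adj G v w ≡ true) uw (adj-xor uv w))

  completeBipartite⇒Iso-K : ∃ IsCompleteBipartite → ∃₂ (λ a b → Σ (a + b ≡ n) (λ _ → Iso G (K a b)))
  completeBipartite⇒Iso-K (c , bip) = a , b , sizes , F , preserves
    where
    open ColourSplit (colourSplit n c)
    F : Fin n ↔ Fin (a + b)
    F = ↔-sym FinP.+↔⊎ ↔-∘ bij
    side : ∀ x → inA {a} {b} (Inverse.to F x) ≡ c x
    side x = trans (inA-join a b (Inverse.to bij x)) (colour x)
    preserves : ∀ i j → adj G i j ≡ adj (K a b) (Inverse.to F i) (Inverse.to F j)
    preserves i j = trans (bip i j) (sym (cong₂ _xor_ (side i) (side j)))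

module _ {k : ℕ} (G : Graph (suc k)) where

  edge-weight-≥ : DegSumBounded G → ∀ i j → isEdge< G i j ≡ true → + 2 / suc k ℚ.≤ twoOver (deg G i + deg G j)
  edge-weight-≥ bound i j e = twoOver-≥ k (isEdge<⇒deg+deg>0 G e) (bound i j (isEdge<⇒adj G e))

  harmonic-≥ : DegSumBounded G → + (2 * numEdges G) / suc k ℚ.≤ harmonic G
  harmonic-≥ bound = subst (ℚ._≤ harmonic G) (edgeSum-const G 2 k) (edgeSum-mono-≤ G (edge-weight-≥ bound))

  harmonic≡⇒edge-tight : DegSumBounded G → harmonic G ≡ + (2 * numEdges G) / suc k →
                         ∀ {i j} → isEdge< G i j ≡ true → deg G i + deg G j ≡ suc k
  harmonic≡⇒edge-tight bound H≡ {i} {j} e with deg G i + deg G j ℕP.≟ suc k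
  ... | yes tight = tight
  ... | no ¬tight = contradiction (sym H≡) (ℚP.<⇒≢ (subst (ℚ._< harmonic G) (edgeSum-const G 2 k)
        (edgeSum-mono-< G (edge-weight-≥ bound) e
          (twoOver-> k (isEdge<⇒deg+deg>0 G e) (ℕP.≤∧≢⇒< (bound i j (isEdge<⇒adj G e)) ¬tight)))))

  harmonic≡⇒degSumTight : DegSumBounded G → harmonic G ≡ + (2 * numEdges G) / suc k → DegSumTight G
  harmonic≡⇒degSumTight bound H≡ u v uv with adj⇒isEdge< G uv
  ... | inj₁ e = harmonic≡⇒edge-tight bound H≡ e
  ... | inj₂ e = trans (ℕP.+-comm (deg G u) (deg G v)) (harmonic≡⇒edge-tight bound H≡ e)

  degSumTight⇒harmonic≡ : DegSumTight G → harmonic G ≡ + (2 * numEdges G) / suc k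
  degSumTight⇒harmonic≡ tight =
    trans (edgeSum-cong G (λ i j e → cong twoOver (tight i j (isEdge<⇒adj G e)))) (edgeSum-const G 2 k)

  harmonic≡⇔degSumTight : DegSumBounded G → (harmonic G ≡ + (2 * numEdges G) / suc k) ⇔ DegSumTight G
  harmonic≡⇔degSumTight bound = mk⇔ (harmonic≡⇒degSumTight bound) degSumTight⇒harmonic≡

  triangleFree⇒harmonic≡⇔Iso-K : TriangleFree G →
    (harmonic G ≡ + (2 * numEdges G) / suc k) ⇔ ∃₂ (λ a b → Σ (a + b ≡ suc k) (λ _ → Iso G (K a b)))
  triangleFree⇒harmonic≡⇔Iso-K tf = mk⇔ to from
    where
    to : harmonic G ≡ + (2 * numEdges G) / suc k → ∃₂ (λ a b → Σ (a + b ≡ suc k) (λ _ → Iso G (K a b)))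
    to H≡ = completeBipartite⇒Iso-K G
      (triangleFree⇒degSumTight⇒completeBipartite G tf (harmonic≡⇒degSumTight (triangleFree⇒degSumBounded G tf) H≡))
    from : ∃₂ (λ a b → Σ (a + b ≡ suc k) (λ _ → Iso G (K a b))) → harmonic G ≡ + (2 * numEdges G) / suc k
    -- adj (K a b) x y is inA x xor inA y by definition, so an isomorphism onto K a b is a complete bipartite colouring.
    from (a , b , _ , F , preserves) =
      degSumTight⇒harmonic≡ (completeBipartite⇒degSumTight G (inA {a} {b} ∘ Inverse.to F) preserves)

mainTheorem1 : ((n : ℕ) → .{{_ : NonZero n}} → (G : Graph n) → Connected G
    → (∀ (u v : Fin n) → adj G u v ≡ true → deg G u + deg G v ≤ n)
    → ((+ (2 * numEdges G) / n) ℚ.≤ harmonic G)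
    × ((harmonic G ≡ (+ (2 * numEdges G) / n))
    ⇔ (∀ (u v : Fin n) → adj G u v ≡ true → deg G u + deg G v ≡ n)))
    × ((n : ℕ) → (G : Graph n) → TriangleFree G
    → ∀ (u v : Fin n) → adj G u v ≡ true → deg G u + deg G v ≤ n)
    × ((n : ℕ) → .{{_ : NonZero n}} → (G : Graph n) → Connected G → TriangleFree G
    → ((harmonic G ≡ (+ (2 * numEdges G) / n))
    ⇔ ∃₂ (λ a b → Σ (a + b ≡ n) (λ _ → Iso G (K a b)))))
mainTheorem1 =
    (λ { zero {{nz}} _ _ _ → ⊥-elim-irr (NonZero.nonZero nz)
       ; (suc k) G _ bound → harmonic-≥ G bound , harmonic≡⇔degSumTight G bound })
  , (λ _ → triangleFree⇒degSumBounded)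
  , (λ { zero {{nz}} _ _ _ → ⊥-elim-irr (NonZero.nonZero nz)
       ; (suc k) G _ tf → triangleFree⇒harmonic≡⇔Iso-K G tf })
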